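{- Let $G$ be a finite simple graph that is $(P_3\cup P_2, W_4, K_4)$-free. Then $\chi(G)\le 6$.
   Context: All graphs are finite and simple. $P_k$ denotes the path on $k$ vertices, $C_k$ the cycle on $k$ vertices, $K_n$ the complete graph on $n$ vertices. $P_3\cup P_2$ is the disjoint union of $P_3$ and $P_2$. $W_4=K_1+C_4$ is the graph consisting of an induced 4-cycle together with a vertex adjacent to all four of its vertices. A graph is $(H_1,\dots,H_k)$-free if it has no induced subgraph isomorphic to any $H_i$. $\chi(G)$ is the chromatic number of $G$. -}

module Defs where

open import Data.Nat using (ℕ)
open import Data.Fin using (Fin; zero; suc)
open import Data.Bool using (Bool; true; false)
open import Data.Product using (Σ; _×_; ∃)
open import Relation.Binary.PropositionalEquality using (_≡_; _≢_)
open import Relation.Nullary using (¬_)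
open import Function.Definitions using (Injective)

record Graph : Set where
  field
    n     : ℕ
    adj   : Fin n → Fin n → Bool
    sym   : ∀ u v → adj u v ≡ adj v u
    irrefl : ∀ v → adj v v ≡ false
open Graph public

InducedSub : Graph → Graph → Set
InducedSub H G =
  Σ (Fin (n H) → Fin (n G)) λ f →
    Injective _≡_ _≡_ f × (∀ u v → adj G (f u) (f v) ≡ adj H u v)

Free : Graph → Graph → Set
Free G H = ¬ InducedSub H G

ProperColouring : Graph → ℕ → Set
ProperColouring G k =
  Σ (Fin (n G) → Fin k) λ c → ∀ u v → adj G u v ≡ true → c u ≢ c v

χ≤ : Graph → ℕ → Set
χ≤ G k = ProperColouring G k

k4adj : Fin 4 → Fin 4 → Bool
k4adj zero zero = false
k4adj (suc zero) (suc zero) = false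
k4adj (suc (suc zero)) (suc (suc zero)) = false
k4adj (suc (suc (suc zero))) (suc (suc (suc zero))) = false
k4adj _ _ = true

K4 : Graph
K4 = record { n = 4 ; adj = k4adj ; sym = s ; irrefl = i }
  where
  s : ∀ u v → k4adj u v ≡ k4adj v u
  s zero zero = _≡_.refl
  s zero (suc zero) = _≡_.refl
  s zero (suc (suc zero)) = _≡_.refl
  s zero (suc (suc (suc zero))) = _≡_.refl
  s (suc zero) zero = _≡_.refl
  s (suc zero) (suc zero) = _≡_.refl
  s (suc zero) (suc (suc zero)) = _≡_.refl
  s (suc zero) (suc (suc (suc zero))) = _≡_.refl
  s (suc (suc zero)) zero = _≡_.refl
  s (suc (suc zero)) (suc zero) = _≡_.refl
  s (suc (suc zero)) (suc (suc zero)) = _≡_.refl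
  s (suc (suc zero)) (suc (suc (suc zero))) = _≡_.refl
  s (suc (suc (suc zero))) zero = _≡_.refl
  s (suc (suc (suc zero))) (suc zero) = _≡_.refl
  s (suc (suc (suc zero))) (suc (suc zero)) = _≡_.refl
  s (suc (suc (suc zero))) (suc (suc (suc zero))) = _≡_.refl
  i : ∀ v → k4adj v v ≡ false
  i zero = _≡_.refl
  i (suc zero) = _≡_.refl
  i (suc (suc zero)) = _≡_.refl
  i (suc (suc (suc zero))) = _≡_.refl

-- W4 = K1 + C4 on Fin 5: vertices 0,1,2,3 form the cycle 0-1-2-3-0,
-- vertex 4 is the hub adjacent to all of 0..3.
w4adj : Fin 5 → Fin 5 → Bool
w4adj zero (suc zero) = true
w4adj (suc zero) zero = true
w4adj (suc zero) (suc (suc zero)) = true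
w4adj (suc (suc zero)) (suc zero) = true
w4adj (suc (suc zero)) (suc (suc (suc zero))) = true
w4adj (suc (suc (suc zero))) (suc (suc zero)) = true
w4adj (suc (suc (suc zero))) zero = true
w4adj zero (suc (suc (suc zero))) = true
w4adj (suc (suc (suc (suc zero)))) zero = true
w4adj (suc (suc (suc (suc zero)))) (suc zero) = true
w4adj (suc (suc (suc (suc zero)))) (suc (suc zero)) = true
w4adj (suc (suc (suc (suc zero)))) (suc (suc (suc zero))) = true
w4adj zero (suc (suc (suc (suc zero)))) = true
w4adj (suc zero) (suc (suc (suc (suc zero)))) = true
w4adj (suc (suc zero)) (suc (suc (suc (suc zero)))) = true
w4adj (suc (suc (suc zero))) (suc (suc (suc (suc zero)))) = true
w4adj _ _ = false

-- P3 ∪ P2 on Fin 5: path 0-1-2, and edge 3-4.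
p32adj : Fin 5 → Fin 5 → Bool
p32adj zero (suc zero) = true
p32adj (suc zero) zero = true
p32adj (suc zero) (suc (suc zero)) = true
p32adj (suc (suc zero)) (suc zero) = true
p32adj (suc (suc (suc zero))) (suc (suc (suc (suc zero)))) = true
p32adj (suc (suc (suc (suc zero)))) (suc (suc (suc zero))) = true
p32adj _ _ = false


W4 : Graph
W4 = record { n = 5 ; adj = w4adj ; sym = s ; irrefl = i }
  where
  s : ∀ u v → w4adj u v ≡ w4adj v u
  s zero zero = _≡_.refl
  s zero (suc zero) = _≡_.refl
  s zero (suc (suc zero)) = _≡_.refl
  s zero (suc (suc (suc zero))) = _≡_.refl
  s zero (suc (suc (suc (suc zero)))) = _≡_.refl
  s (suc zero) zero = _≡_.refl
  s (suc zero) (suc zero) = _≡_.refl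
  s (suc zero) (suc (suc zero)) = _≡_.refl
  s (suc zero) (suc (suc (suc zero))) = _≡_.refl
  s (suc zero) (suc (suc (suc (suc zero)))) = _≡_.refl
  s (suc (suc zero)) zero = _≡_.refl
  s (suc (suc zero)) (suc zero) = _≡_.refl
  s (suc (suc zero)) (suc (suc zero)) = _≡_.refl
  s (suc (suc zero)) (suc (suc (suc zero))) = _≡_.refl
  s (suc (suc zero)) (suc (suc (suc (suc zero)))) = _≡_.refl
  s (suc (suc (suc zero))) zero = _≡_.refl
  s (suc (suc (suc zero))) (suc zero) = _≡_.refl
  s (suc (suc (suc zero))) (suc (suc zero)) = _≡_.refl
  s (suc (suc (suc zero))) (suc (suc (suc zero))) = _≡_.refl
  s (suc (suc (suc zero))) (suc (suc (suc (suc zero)))) = _≡_.refl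
  s (suc (suc (suc (suc zero)))) zero = _≡_.refl
  s (suc (suc (suc (suc zero)))) (suc zero) = _≡_.refl
  s (suc (suc (suc (suc zero)))) (suc (suc zero)) = _≡_.refl
  s (suc (suc (suc (suc zero)))) (suc (suc (suc zero))) = _≡_.refl
  s (suc (suc (suc (suc zero)))) (suc (suc (suc (suc zero)))) = _≡_.refl
  i : ∀ v → w4adj v v ≡ false
  i zero = _≡_.refl
  i (suc zero) = _≡_.refl
  i (suc (suc zero)) = _≡_.refl
  i (suc (suc (suc zero))) = _≡_.refl
  i (suc (suc (suc (suc zero)))) = _≡_.refl

P3∪P2 : Graph
P3∪P2 = record { n = 5 ; adj = p32adj ; sym = s ; irrefl = i }
  where
  s : ∀ u v → p32adj u v ≡ p32adj v u
  s zero zero = _≡_.refl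
  s zero (suc zero) = _≡_.refl
  s zero (suc (suc zero)) = _≡_.refl
  s zero (suc (suc (suc zero))) = _≡_.refl
  s zero (suc (suc (suc (suc zero)))) = _≡_.refl
  s (suc zero) zero = _≡_.refl
  s (suc zero) (suc zero) = _≡_.refl
  s (suc zero) (suc (suc zero)) = _≡_.refl
  s (suc zero) (suc (suc (suc zero))) = _≡_.refl
  s (suc zero) (suc (suc (suc (suc zero)))) = _≡_.refl
  s (suc (suc zero)) zero = _≡_.refl
  s (suc (suc zero)) (suc zero) = _≡_.refl
  s (suc (suc zero)) (suc (suc zero)) = _≡_.refl
  s (suc (suc zero)) (suc (suc (suc zero))) = _≡_.refl
  s (suc (suc zero)) (suc (suc (suc (suc zero)))) = _≡_.refl
  s (suc (suc (suc zero))) zero = _≡_.refl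
  s (suc (suc (suc zero))) (suc zero) = _≡_.refl
  s (suc (suc (suc zero))) (suc (suc zero)) = _≡_.refl
  s (suc (suc (suc zero))) (suc (suc (suc zero))) = _≡_.refl
  s (suc (suc (suc zero))) (suc (suc (suc (suc zero)))) = _≡_.refl
  s (suc (suc (suc (suc zero)))) zero = _≡_.refl
  s (suc (suc (suc (suc zero)))) (suc zero) = _≡_.refl
  s (suc (suc (suc (suc zero)))) (suc (suc zero)) = _≡_.refl
  s (suc (suc (suc (suc zero)))) (suc (suc (suc zero))) = _≡_.refl
  s (suc (suc (suc (suc zero)))) (suc (suc (suc (suc zero)))) = _≡_.refl
  i : ∀ v → p32adj v v ≡ false
  i zero = _≡_.refl
  i (suc zero) = _≡_.refl
  i (suc (suc zero)) = _≡_.refl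
  i (suc (suc (suc zero))) = _≡_.refl
  i (suc (suc (suc (suc zero)))) = _≡_.refl

-- A vertex set S inducing a P3-free subgraph is a disjoint union of cliques, each of size at most
-- three as G is K4-free; ranking every vertex by its position in its clique (for a fixed order)
-- colours G[S] with three colours. Since G is (P3 ∪ P2)-free, the common non-neighbourhood of any
-- edge is such a set. If G contains a diamond (a triangle t₀t₁t₂ and x adjacent to t₀, t₁ only),
-- the vertices are sorted by their neighbours among t₀, t₁, t₂, x into classes that are independent
-- because of the forbidden subgraphs; the vertices missing t₀ and t₁ are ranked with those seeing
-- t₂ first, so that those of rank 2 can join the classes of t₀, t₁ or t₂. Without diamonds (and K4)
-- every edge has at most one common neighbour, so for a triangle v₀a₀b₀ the neighbourhood of v₀
-- induces a matching and the other vertices are split by their adjacency to a₀ and b₀. Without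
-- triangles the two neighbourhoods of an edge are independent and its common non-neighbourhood is a
-- matching.
module Submission where

open import Defs
open import Data.Bool using (Bool; true; false)
import Data.Bool as Bool
open import Data.Empty using (⊥; ⊥-elim)
open import Data.Fin using (Fin; zero; toℕ; inject≤; _<_; #_)
import Data.Fin.Properties as Fin
open import Data.List using (List; allFin; cartesianProduct; filter)
open import Data.List.Membership.Propositional using (_∈_)
open import Data.List.Membership.Propositional.Properties using (∈-filter⁺; ∈-cartesianProduct⁺; ∈-allFin)
import Data.List.Relation.Unary.All as List
open import Data.List.Relation.Unary.All using ([]; _∷_)
open import Data.Nat as ℕ using (ℕ; _≤_)
import Data.Nat.Properties as ℕ
open import Data.Product using (∃; _×_; _,_; proj₁; proj₂; uncurry)
open import Data.Sum using (_⊎_; inj₁; inj₂; [_,_])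
open import Data.Vec using (Vec; []; _∷_; lookup)
open import Data.Vec.Relation.Unary.All using (All; []; _∷_)
open import Data.Vec.Relation.Unary.All.Properties using (lookup⁺)
open import Function using (_∘_)
open import Level using (0ℓ)
open import Relation.Binary using (tri<; tri≈; tri>)
open import Relation.Binary.PropositionalEquality as ≡ using (_≡_; _≢_; refl; trans; cong; subst)
open import Relation.Nullary using (¬_; Dec; yes; no)
open import Relation.Nullary.Decidable using (_×-dec_; _⊎-dec_; ¬?; map′)
open import Relation.Unary using (Pred; Decidable; _∪_; _∩_; ∁; ｛_｝; _⊆_)

Twins : (H : Graph) → Fin (n H) → Fin (n H) → Set
Twins H i j = ∀ k → adj H i k ≡ adj H j k

twins? : (H : Graph) (i j : Fin (n H)) → Dec (Twins H i j)
twins? H i j = Fin.all? λ k → adj H i k Bool.≟ adj H j k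

orderedPairs : ∀ m → List (Fin m × Fin m)
orderedPairs m = filter (uncurry Fin._<?_) (cartesianProduct (allFin m) (allFin m))

twinPairs : (H : Graph) → List (Fin (n H) × Fin (n H))
twinPairs H = filter (uncurry (twins? H)) (orderedPairs (n H))

∈-orderedPairs : ∀ {m} {i j : Fin m} → i < j → (i , j) ∈ orderedPairs m
∈-orderedPairs {i = i} {j} i<j =
  ∈-filter⁺ (uncurry Fin._<?_) (∈-cartesianProduct⁺ (∈-allFin i) (∈-allFin j)) i<j

module _ (G : Graph) where

  V : Set
  V = Fin (n G)

  infix 4 _~_ _≁_ _~?_ _≁?_
  _~_ _≁_ : V → V → Set
  u ~ v = adj G u v ≡ true
  u ≁ v = adj G u v ≡ false

  _~?_ : ∀ u v → Dec (u ~ v)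
  u ~? v = adj G u v Bool.≟ true

  _≁?_ : ∀ u v → Dec (u ≁ v)
  u ≁? v = adj G u v Bool.≟ false

  ~-dichotomy : ∀ u v → u ~ v ⊎ u ≁ v
  ~-dichotomy u v with adj G u v
  ... | true  = inj₁ refl
  ... | false = inj₂ refl

  ~-sym : ∀ {u v} → u ~ v → v ~ u
  ~-sym {u} {v} u~v = trans (sym G v u) u~v

  ≁-sym : ∀ {u v} → u ≁ v → v ≁ u
  ≁-sym {u} {v} u≁v = trans (sym G v u) u≁v

  ~-≁-apart : ∀ {u v w} → u ~ w → v ≁ w → u ≢ v
  ~-≁-apart u~w v≁w refl with () ← trans (≡.sym u~w) v≁w

  ~-irrefl : ∀ {u v} → u ~ v → u ≢ v
  ~-irrefl {u} u~v refl = ~-≁-apart u~v (irrefl G u) refl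

  -- An adjacency-preserving map can only identify twins of H, so injectivity has to be checked on
  -- twin pairs only, and by symmetry adjacency on pairs i < j only.
  induced-copy : (H : Graph) (f : Fin (n H) → V) →
                 List.All (λ (i , j) → adj G (f i) (f j) ≡ adj H i j) (orderedPairs (n H)) →
                 List.All (λ (i , j) → f i ≢ f j) (twinPairs H) →
                 InducedSub H G
  induced-copy H f upper separated = f , injective , preserves
    where
    preserves : ∀ i j → adj G (f i) (f j) ≡ adj H i j
    preserves i j with Fin.<-cmp i j
    ... | tri< i<j _ _ = List.lookup upper (∈-orderedPairs i<j)
    ... | tri≈ _ refl _ = trans (irrefl G (f i)) (≡.sym (irrefl H i))
    ... | tri> _ _ j<i =
      trans (sym G (f i) (f j)) (trans (List.lookup upper (∈-orderedPairs j<i)) (sym H j i))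

    twins : ∀ {i j} → f i ≡ f j → Twins H i j
    twins {i} {j} fi≡fj k = begin
      adj H i k         ≡⟨ ≡.sym (preserves i k) ⟩
      adj G (f i) (f k) ≡⟨ cong (λ v → adj G v (f k)) fi≡fj ⟩
      adj G (f j) (f k) ≡⟨ preserves j k ⟩
      adj H j k         ∎
      where open ≡.≡-Reasoning

    apart : ∀ {i j} → i < j → f i ≢ f j
    apart i<j fi≡fj =
      List.lookup separated (∈-filter⁺ (uncurry (twins? H)) (∈-orderedPairs i<j) (twins fi≡fj)) fi≡fj

    injective : ∀ {i j} → f i ≡ f j → i ≡ j
    injective {i} {j} fi≡fj with Fin.<-cmp i j
    ... | tri< i<j _ _ = ⊥-elim (apart i<j fi≡fj)
    ... | tri≈ _ i≡j _ = i≡j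
    ... | tri> _ _ j<i = ⊥-elim (apart j<i (≡.sym fi≡fj))

  TriangleFree : Set
  TriangleFree = ∀ {a b c} → a ~ b → b ~ c → a ~ c → ⊥

  K4Free : Set
  K4Free = ∀ {a b c d} → a ~ b → a ~ c → a ~ d → b ~ c → b ~ d → c ~ d → ⊥

  triangle-free⇒K4Free : TriangleFree → K4Free
  triangle-free⇒K4Free triangle-free ab ac _ bc _ _ = triangle-free ab bc ac

  no-K4 : Free G K4 → K4Free
  no-K4 K4-free {a} {b} {c} {d} ab ac ad bc bd cd =
    K4-free (induced-copy K4 (lookup (a ∷ b ∷ c ∷ d ∷ [])) (ab ∷ ac ∷ ad ∷ bc ∷ bd ∷ cd ∷ []) [])

  no-W4 : Free G W4 → ∀ {r₀ r₁ r₂ r₃ h} →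
          r₀ ~ r₁ → r₀ ≁ r₂ → r₀ ~ r₃ → r₀ ~ h → r₁ ~ r₂ → r₁ ≁ r₃ → r₁ ~ h → r₂ ~ r₃ → r₂ ~ h → r₃ ~ h →
          r₀ ≢ r₂ → r₁ ≢ r₃ → ⊥
  no-W4 W4-free {r₀} {r₁} {r₂} {r₃} {h} e₀₁ n₀₂ e₀₃ e₀h e₁₂ n₁₃ e₁h e₂₃ e₂h e₃h r₀≢r₂ r₁≢r₃ =
    W4-free (induced-copy W4 (lookup (r₀ ∷ r₁ ∷ r₂ ∷ r₃ ∷ h ∷ []))
      (e₀₁ ∷ n₀₂ ∷ e₀₃ ∷ e₀h ∷ e₁₂ ∷ n₁₃ ∷ e₁h ∷ e₂₃ ∷ e₂h ∷ e₃h ∷ []) (r₀≢r₂ ∷ r₁≢r₃ ∷ []))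

  no-P3∪P2 : Free G P3∪P2 → ∀ {a b c d e} →
             a ~ b → b ~ c → a ≁ c → a ≢ c → d ~ e →
             a ≁ d → a ≁ e → b ≁ d → b ≁ e → c ≁ d → c ≁ e → ⊥
  no-P3∪P2 P3∪P2-free {a} {b} {c} {d} {e} ab bc a≁c a≢c de a≁d a≁e b≁d b≁e c≁d c≁e =
    P3∪P2-free (induced-copy P3∪P2 (lookup (a ∷ b ∷ c ∷ d ∷ e ∷ []))
      (ab ∷ a≁c ∷ a≁d ∷ a≁e ∷ bc ∷ b≁d ∷ b≁e ∷ c≁d ∷ c≁e ∷ de ∷ []) (a≢c ∷ []))

  Independent : Pred V 0ℓ → Set
  Independent A = ∀ {u v} → A u → A v → ¬ u ~ v

  independent-⊆ : ∀ {A B} → A ⊆ B → Independent B → Independent A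
  independent-⊆ A⊆B independent a a′ = independent (A⊆B a) (A⊆B a′)

  ∪-independent : ∀ {A B} → Independent A → Independent B → (∀ {u v} → A u → B v → ¬ u ~ v) →
                  Independent (A ∪ B)
  ∪-independent indA indB cross (inj₁ a) (inj₁ a′) = indA a a′
  ∪-independent indA indB cross (inj₁ a) (inj₂ b)  = cross a b
  ∪-independent indA indB cross (inj₂ b) (inj₁ a)  = cross a b ∘ ~-sym
  ∪-independent indA indB cross (inj₂ b) (inj₂ b′) = indB b b′

  ｛｝∪-independent : ∀ {t B} → Independent B → (∀ {v} → B v → v ≁ t) → Independent (｛ t ｝ ∪ B)
  ｛｝∪-independent indB B≁t =
    ∪-independent (λ { refl refl t~t → ~-irrefl t~t refl }) indB
                  (λ { refl b t~v → ~-≁-apart (~-sym t~v) (B≁t b) refl })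

  HasNeighbourIn : Pred V 0ℓ → Pred V 0ℓ
  HasNeighbourIn B v = ∃ λ b → B b × v ~ b

  hasNeighbourIn? : ∀ {B} → Decidable B → Decidable (HasNeighbourIn B)
  hasNeighbourIn? B? v = Fin.any? λ b → B? b ×-dec v ~? b

  ∪-non-neighbours-independent : ∀ {A B} → Independent B → Independent A →
                                 Independent (B ∪ A ∩ ∁ (HasNeighbourIn B))
  ∪-non-neighbours-independent indB indA =
    ∪-independent indB (independent-⊆ proj₁ indA) λ b (_ , lonely) b~v → lonely (_ , b , ~-sym b~v)

  colouring-by-classes : ∀ {k} (classes : Vec (Pred V 0ℓ) k) →
                         (∀ v → ∃ λ c → lookup classes c v) → All Independent classes → χ≤ G k
  colouring-by-classes classes cover independent = colour , proper
    where
    colour : V → Fin _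
    colour v = proj₁ (cover v)

    proper : ∀ u v → u ~ v → colour u ≢ colour v
    proper u v u~v same = lookup⁺ independent (colour u) (proj₂ (cover u))
      (subst (λ c → lookup classes c v) (≡.sym same) (proj₂ (cover v))) u~v

  χ≤-mono : ∀ {k m} → k ≤ m → χ≤ G k → χ≤ G m
  χ≤-mono k≤m (colour , proper) =
    (λ v → inject≤ (colour v) k≤m) , λ u v u~v → proper u v u~v ∘ Fin.inject≤-injective k≤m k≤m _ _

  neighbourhood-independent : TriangleFree → ∀ {v} → Independent (_~ v)
  neighbourhood-independent triangle-free u~v w~v u~w = triangle-free u~w w~v u~v

  neighbourhood-triangle-free : K4Free → ∀ {v a b c} → a ~ v → b ~ v → c ~ v → a ~ b → b ~ c → a ~ c → ⊥
  neighbourhood-triangle-free k4 a~v b~v c~v ab bc ac = k4 ab ac a~v bc b~v c~v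

  common-neighbours-independent : K4Free → ∀ {a b} → a ~ b → Independent (λ w → w ~ a × w ~ b)
  common-neighbours-independent k4 ab (u~a , u~b) (w~a , w~b) u~w =
    k4 ab (~-sym u~a) (~-sym w~a) (~-sym u~b) (~-sym w~b) u~w

  P3-non-neighbourhood-independent : Free G P3∪P2 → ∀ {a b c} → a ~ b → b ~ c → a ≁ c → a ≢ c →
                                     Independent (λ w → w ≁ a × w ≁ b × w ≁ c)
  P3-non-neighbourhood-independent P3∪P2-free ab bc a≁c a≢c (u≁a , u≁b , u≁c) (w≁a , w≁b , w≁c) u~w =
    no-P3∪P2 P3∪P2-free ab bc a≁c a≢c u~w
             (≁-sym u≁a) (≁-sym w≁a) (≁-sym u≁b) (≁-sym w≁b) (≁-sym u≁c) (≁-sym w≁c)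

  Clustered : Pred V 0ℓ → Set
  Clustered S = ∀ {a b c} → S a → S b → S c → a ~ b → b ~ c → a ≢ c → a ~ c

  clustered-⊆ : ∀ {S S′} → S ⊆ S′ → Clustered S′ → Clustered S
  clustered-⊆ S⊆S′ clustered a b c = clustered (S⊆S′ a) (S⊆S′ b) (S⊆S′ c)

  edge-non-neighbourhood-clustered : Free G P3∪P2 → ∀ {d e} → d ~ e → Clustered (λ w → w ≁ d × w ≁ e)
  edge-non-neighbourhood-clustered P3∪P2-free de {a} {b} {c} (a≁d , a≁e) (b≁d , b≁e) (c≁d , c≁e) ab bc a≢c
    with ~-dichotomy a c
  ... | inj₁ ac  = ac
  ... | inj₂ a≁c = ⊥-elim (no-P3∪P2 P3∪P2-free ab bc a≁c a≢c de a≁d a≁e b≁d b≁e c≁d c≁e)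

  UniqueCommonNeighbours : Set
  UniqueCommonNeighbours = ∀ {p q r s} → p ~ q → r ~ p → r ~ q → s ~ p → s ~ q → r ≡ s

  neighbourhood-clustered : UniqueCommonNeighbours → ∀ {v} → Clustered (_~ v)
  neighbourhood-clustered unique a~v b~v c~v ab bc a≢c =
    ⊥-elim (a≢c (unique b~v ab a~v (~-sym bc) c~v))

  module _ {P : Pred V 0ℓ} (P? : Decidable P) where

    priority : V → ℕ
    priority v with P? v
    ... | yes _ = toℕ v
    ... | no _  = n G ℕ.+ toℕ v

    priority-injective : ∀ {u v} → priority u ≡ priority v → u ≡ v
    priority-injective {u} {v} eq with P? u | P? v
    ... | yes _ | yes _ = Fin.toℕ-injective eq
    ... | no _  | no _  = Fin.toℕ-injective (ℕ.+-cancelˡ-≡ (n G) _ _ eq)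
    ... | yes _ | no _  = ⊥-elim (ℕ.<-irrefl eq (ℕ.<-≤-trans (Fin.toℕ<n u) (ℕ.m≤m+n _ _)))
    ... | no _  | yes _ = ⊥-elim (ℕ.<-irrefl (≡.sym eq) (ℕ.<-≤-trans (Fin.toℕ<n v) (ℕ.m≤m+n _ _)))

    priority-first : ∀ {u v} → P v → priority u ℕ.< priority v → P u
    priority-first {u} {v} pv u<v with P? u | P? v
    ... | yes pu | _      = pu
    ... | no _   | yes _  = ⊥-elim (ℕ.<-asym u<v (ℕ.<-≤-trans (Fin.toℕ<n v) (ℕ.m≤m+n _ _)))
    ... | no _   | no ¬pv = ⊥-elim (¬pv pv)

  -- Adjacent vertices of a clustered set lie in one clique of G[S]; listed in ≺-order, the vertices
  -- of a clique get ranks 0, 1, 2, 2, …, and K4-freeness bounds cliques by three, so the ranks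
  -- properly colour G[S].
  module Ranking (k4 : K4Free) {S : Pred V 0ℓ} (S? : Decidable S) (key : V → ℕ)
                 (key-injective : ∀ {u v} → key u ≡ key v → u ≡ v) (clustered : Clustered S) where

    infix 4 _≺_
    _≺_ : V → V → Set
    u ≺ v = key u ℕ.< key v

    ≺⇒≢ : ∀ {u v} → u ≺ v → u ≢ v
    ≺⇒≢ u≺v refl = ℕ.<-irrefl refl u≺v

    EarlierNeighbour : V → Pred V 0ℓ
    EarlierNeighbour v w = S w × w ≺ v × w ~ v

    earlierNeighbour? : ∀ v → Decidable (EarlierNeighbour v)
    earlierNeighbour? v w = S? w ×-dec key w ℕ.<? key v ×-dec w ~? v

    HasEarlier : Pred V 0ℓ
    HasEarlier v = ∃ (EarlierNeighbour v)

    HasEarlier² : Pred V 0ℓ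
    HasEarlier² v = ∃ λ w → EarlierNeighbour v w × HasEarlier w

    hasEarlier? : Decidable HasEarlier
    hasEarlier? v = Fin.any? (earlierNeighbour? v)

    hasEarlier²? : Decidable HasEarlier²
    hasEarlier²? v = Fin.any? λ w → earlierNeighbour? v w ×-dec hasEarlier? w

    data Rank (v : V) : ℕ → Set where
      first  : ¬ HasEarlier v → Rank v 0
      second : HasEarlier v → ¬ HasEarlier² v → Rank v 1
      third  : HasEarlier² v → Rank v 2

    rank : ∀ v → ∃ (Rank v)
    rank v with hasEarlier²? v | hasEarlier? v
    ... | yes h² | _     = 2 , third h²
    ... | no ¬h² | yes h = 1 , second h ¬h²
    ... | no _   | no ¬h = 0 , first ¬h

    Ranked : ℕ → Pred V 0ℓ
    Ranked r v = S v × Rank v r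

    ranked₀? : Decidable (Ranked 0)
    ranked₀? v = S? v ×-dec map′ first (λ { (first ¬h) → ¬h }) (¬? (hasEarlier? v))

    record EarlierTriangle (v : V) : Set where
      field
        w₀ w₁ : V
        S-w₀ : S w₀
        S-w₁ : S w₁
        w₀≺v : w₀ ≺ v
        w₁≺v : w₁ ≺ v
        w₀~w₁ : w₀ ~ w₁
        w₀~v : w₀ ~ v
        w₁~v : w₁ ~ v

    earlierTriangle : ∀ {v} → Ranked 2 v → EarlierTriangle v
    earlierTriangle {v} (sv , third (w₁ , (s₁ , w₁≺v , w₁~v) , w₀ , (s₀ , w₀≺w₁ , w₀~w₁))) = record
      { w₀ = w₀ ; w₁ = w₁ ; S-w₀ = s₀ ; S-w₁ = s₁ ; w₀≺v = w₀≺v ; w₁≺v = w₁≺v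
      ; w₀~w₁ = w₀~w₁ ; w₀~v = clustered s₀ s₁ sv w₀~w₁ w₁~v (≺⇒≢ w₀≺v) ; w₁~v = w₁~v }
      where
      w₀≺v = ℕ.<-trans w₀≺w₁ w₁≺v

    ¬Ranked₂ : (∀ {a b c} → S a → S b → S c → a ~ b → b ~ c → a ~ c → ⊥) → ∀ {v} → ¬ Ranked 2 v
    ¬Ranked₂ no-triangle r₂@(sv , _) = no-triangle S-w₀ S-w₁ sv w₀~w₁ w₁~v w₀~v
      where open EarlierTriangle (earlierTriangle r₂)

    private
      earlier-same-rank : ∀ {r} u v → Ranked r u → Ranked r v → u ≺ v → ¬ u ~ v
      earlier-same-rank _ _ (su , first _) (sv , first ¬h) u≺v u~v = ¬h (_ , su , u≺v , u~v)
      earlier-same-rank _ _ (su , second h _) (sv , second _ ¬h²) u≺v u~v = ¬h² (_ , (su , u≺v , u~v) , h)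
      earlier-same-rank u v ru@(su , third _) (sv , third _) u≺v u~v =
        k4 w₀~w₁ w₀~v (extend S-w₀ w₀~v w₀≺v) w₁~v (extend S-w₁ w₁~v w₁≺v) u~v
        where
        open EarlierTriangle (earlierTriangle ru)
        extend : ∀ {w} → S w → w ~ u → w ≺ u → w ~ v
        extend sw w~u w≺u = clustered sw su sv w~u u~v (≺⇒≢ (ℕ.<-trans w≺u u≺v))

    ranked-independent : ∀ r → Independent (Ranked r)
    ranked-independent r {u} {v} ru rv u~v with ℕ.<-cmp (key u) (key v)
    ... | tri< u≺v _ _  = earlier-same-rank u v ru rv u≺v u~v
    ... | tri≈ _ same _ = ~-irrefl u~v (key-injective same)
    ... | tri> _ _ v≺u  = earlier-same-rank v u rv ru v≺u (~-sym u~v)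

  module TriangleFreeCase (P3∪P2-free : Free G P3∪P2) (triangle-free : TriangleFree)
                          {u₀ v₀} (u₀~v₀ : u₀ ~ v₀) where

    Far : Pred V 0ℓ
    Far w = w ≁ u₀ × w ≁ v₀

    far? : Decidable Far
    far? w = w ≁? u₀ ×-dec w ≁? v₀

    open Ranking (triangle-free⇒K4Free triangle-free) far? toℕ Fin.toℕ-injective
                 (edge-non-neighbourhood-clustered P3∪P2-free u₀~v₀)

    classes : Vec (Pred V 0ℓ) 4
    classes = (_~ u₀) ∷ (_~ v₀) ∷ Ranked 0 ∷ Ranked 1 ∷ []

    cover : ∀ w → ∃ λ c → lookup classes c w
    cover w with ~-dichotomy w u₀ | ~-dichotomy w v₀ | rank w
    ... | inj₁ w~u₀ | _         | _     = # 0 , w~u₀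
    ... | inj₂ _    | inj₁ w~v₀ | _     = # 1 , w~v₀
    ... | inj₂ w≁u₀ | inj₂ w≁v₀ | 0 , r = # 2 , (w≁u₀ , w≁v₀) , r
    ... | inj₂ w≁u₀ | inj₂ w≁v₀ | 1 , r = # 3 , (w≁u₀ , w≁v₀) , r
    ... | inj₂ w≁u₀ | inj₂ w≁v₀ | 2 , r = ⊥-elim (¬Ranked₂ (λ _ _ _ → triangle-free) ((w≁u₀ , w≁v₀) , r))

    colouring : χ≤ G 4
    colouring = colouring-by-classes classes cover
      (neighbourhood-independent triangle-free ∷ neighbourhood-independent triangle-free ∷
       ranked-independent 0 ∷ ranked-independent 1 ∷ [])

  triangle-free⇒χ≤4 : Free G P3∪P2 → TriangleFree → χ≤ G 4
  triangle-free⇒χ≤4 P3∪P2-free triangle-free with Fin.any? (λ u → Fin.any? (u ~?_))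
  ... | yes (_ , _ , u₀~v₀) = TriangleFreeCase.colouring P3∪P2-free triangle-free u₀~v₀
  ... | no edgeless         = (λ _ → zero) , λ u v u~v _ → edgeless (u , v , u~v)

  Diamond : V → V → V → V → Set
  Diamond t₀ t₁ t₂ x = t₀ ~ t₁ × t₁ ~ t₂ × t₀ ~ t₂ × x ~ t₀ × x ~ t₁ × x ≁ t₂ × x ≢ t₂

  DiamondFree : Set
  DiamondFree = ∀ {t₀ t₁ t₂ x} → ¬ Diamond t₀ t₁ t₂ x

  diamond? : Dec (∃ λ t₀ → ∃ λ t₁ → ∃ λ t₂ → ∃ (Diamond t₀ t₁ t₂))
  diamond? = Fin.any? λ t₀ → Fin.any? λ t₁ → Fin.any? λ t₂ → Fin.any? λ x →
    t₀ ~? t₁ ×-dec t₁ ~? t₂ ×-dec t₀ ~? t₂ ×-dec x ~? t₀ ×-dec x ~? t₁ ×-dec x ≁? t₂ ×-dec ¬? (x Fin.≟ t₂)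

  unique-common-neighbours : K4Free → DiamondFree → UniqueCommonNeighbours
  unique-common-neighbours k4 diamond-free {p} {q} {r} {s} pq rp rq sp sq with r Fin.≟ s
  ... | yes r≡s = r≡s
  ... | no r≢s with ~-dichotomy r s
  ...   | inj₁ rs  = ⊥-elim (k4 pq (~-sym rp) (~-sym sp) (~-sym rq) (~-sym sq) rs)
  ...   | inj₂ r≁s = ⊥-elim (diamond-free (pq , ~-sym rq , ~-sym rp , sp , sq , ≁-sym r≁s , r≢s ∘ ≡.sym))

  module DiamondFreeCase (P3∪P2-free : Free G P3∪P2) (k4 : K4Free) (unique : UniqueCommonNeighbours)
                         {v₀ a₀ b₀} (v₀~a₀ : v₀ ~ a₀) (v₀~b₀ : v₀ ~ b₀) (a₀~b₀ : a₀ ~ b₀) where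

    Far : Pred V 0ℓ
    Far w = w ≢ v₀ × w ≁ v₀

    far? : Decidable Far
    far? w = ¬? (w Fin.≟ v₀) ×-dec w ≁? v₀

    module N = Ranking k4 (_~? v₀) toℕ Fin.toℕ-injective (neighbourhood-clustered unique)

    A : Pred V 0ℓ
    A = Far ∩ (_≁ a₀) ∩ (_≁ b₀)

    A? : Decidable A
    A? w = far? w ×-dec w ≁? a₀ ×-dec w ≁? b₀

    module RA = Ranking k4 A? toℕ Fin.toℕ-injective
      (clustered-⊆ {S = A} (λ ((_ , w≁v₀) , _ , w≁b₀) → w≁v₀ , w≁b₀)
                   (edge-non-neighbourhood-clustered P3∪P2-free v₀~b₀))

    module Side {c c′} (v₀~c : v₀ ~ c) (v₀~c′ : v₀ ~ c′) (A-misses : ∀ {w} → A w → w ≁ c × w ≁ c′) where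

      X : Pred V 0ℓ
      X = Far ∩ (_~ c) ∩ (_≁ c′)

      X? : Decidable X
      X? w = far? w ×-dec w ~? c ×-dec w ≁? c′

      module RX = Ranking k4 X? toℕ Fin.toℕ-injective
        (clustered-⊆ {S = X} (λ (_ , w~c , _) → w~c) (neighbourhood-clustered unique))

      X-ranks : ∀ {w} → X w → RX.Ranked 0 w ⊎ RX.Ranked 1 w
      X-ranks {w} xw with RX.rank w
      ... | 0 , r = inj₁ (xw , r)
      ... | 1 , r = inj₂ (xw , r)
      ... | 2 , r = ⊥-elim (RX.¬Ranked₂ (λ (_ , a~c , _) (_ , b~c , _) (_ , d~c , _) →
                                           neighbourhood-triangle-free k4 a~c b~c d~c) (xw , r))

      X-A-trans : ∀ {x y z} → X x → A y → A z → x ~ y → y ~ z → x ~ z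
      X-A-trans {x} {y} {z} ((_ , x≁v₀) , x~c , x≁c′) ay@((_ , y≁v₀) , _) az@((_ , z≁v₀) , _) xy yz
        with ~-dichotomy x z
      ... | inj₁ xz  = xz
      ... | inj₂ x≁z = ⊥-elim (no-P3∪P2 P3∪P2-free xy yz x≁z (~-≁-apart x~c (proj₁ (A-misses az))) v₀~c′
                                x≁v₀ x≁c′ y≁v₀ (proj₂ (A-misses ay)) z≁v₀ (proj₂ (A-misses az)))

      one-X-neighbour : ∀ {z x₁ x₂} → A z → X x₁ → X x₂ → z ~ x₁ → z ~ x₂ → x₁ ≡ x₂
      one-X-neighbour {z} {x₁} {x₂} az@((_ , z≁v₀) , _) ((_ , x₁≁v₀) , x₁~c , x₁≁c′) ((_ , x₂≁v₀) , x₂~c , x₂≁c′)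
                      z~x₁ z~x₂ with x₁ Fin.≟ x₂
      ... | yes x₁≡x₂ = x₁≡x₂
      ... | no x₁≢x₂ with ~-dichotomy x₁ x₂
      ...   | inj₁ x₁x₂  = ⊥-elim (~-≁-apart (~-sym v₀~c) z≁v₀ (unique x₁x₂ (~-sym x₁~c) (~-sym x₂~c) z~x₁ z~x₂))
      ...   | inj₂ x₁≁x₂ = ⊥-elim (no-P3∪P2 P3∪P2-free (~-sym z~x₁) z~x₂ x₁≁x₂ x₁≢x₂ v₀~c′
                                     x₁≁v₀ x₁≁c′ z≁v₀ (proj₂ (A-misses az)) x₂≁v₀ x₂≁c′)

      no-X-neighbour-of-third : ∀ {z x} → RA.Ranked 2 z → X x → ¬ z ~ x
      no-X-neighbour-of-third r₂@(az , _) xx z~x = k4 (x~ S-w₀ w₀~v) (x~ S-w₁ w₁~v) (~-sym z~x) w₀~w₁ w₀~v w₁~v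
        where
        open RA.EarlierTriangle (RA.earlierTriangle r₂)
        x~ : ∀ {w} → A w → w ~ _ → _ ~ w
        x~ aw w~z = X-A-trans xx az aw (~-sym z~x) (~-sym w~z)

      Pair₀ Pair₁ : ℕ → Pred V 0ℓ
      Pair₀ r = RX.Ranked 0 ∪ RA.Ranked r ∩ ∁ (HasNeighbourIn (RX.Ranked 0))
      Pair₁ r = RX.Ranked 1 ∪ RA.Ranked r ∩ HasNeighbourIn (RX.Ranked 0)

      pair₀-far : ∀ {r} → Pair₀ r ⊆ Far
      pair₀-far (inj₁ ((far , _) , _))       = far
      pair₀-far (inj₂ (((far , _) , _) , _)) = far

      pair₀-independent : ∀ r → Independent (Pair₀ r)
      pair₀-independent r = ∪-non-neighbours-independent (RX.ranked-independent 0) (RA.ranked-independent r)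

      pair₁-independent : ∀ r → Independent (Pair₁ r)
      pair₁-independent r =
        ∪-independent (RX.ranked-independent 1) (independent-⊆ proj₁ (RA.ranked-independent r))
        -- v's only X-neighbour is p, of rank 0, so it cannot be u, of rank 1.
        λ { (xu , RX.second earlier _) ((av , _) , _ , (xp , RX.first no-earlier) , v~p) u~v →
              no-earlier (subst RX.HasEarlier (one-X-neighbour av xu xp (~-sym u~v) v~p) earlier) }

      pair₁-third : ∀ {r u v} → Pair₁ r u → RA.Ranked 2 v → ¬ u ~ v
      pair₁-third (inj₁ (xu , _)) rv u~v = no-X-neighbour-of-third rv xu (~-sym u~v)
      pair₁-third (inj₂ ((au , _) , _ , (xp , _) , u~p)) rv@(av , _) u~v =
        no-X-neighbour-of-third rv xp (~-sym (X-A-trans xp au av (~-sym u~p) u~v))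

    module P = Side v₀~a₀ v₀~b₀ (λ (_ , w≁a₀ , w≁b₀) → w≁a₀ , w≁b₀)
    module Q = Side v₀~b₀ v₀~a₀ (λ (_ , w≁a₀ , w≁b₀) → w≁b₀ , w≁a₀)

    classes : Vec (Pred V 0ℓ) 6
    classes = N.Ranked 0 ∷ N.Ranked 1 ∷ ｛ v₀ ｝ ∪ P.Pair₀ 0 ∷ P.Pair₁ 0 ∪ RA.Ranked 2
            ∷ Q.Pair₀ 1 ∷ Q.Pair₁ 1 ∷ []

    cover-N : ∀ {w} → w ~ v₀ → ∃ λ c → lookup classes c w
    cover-N {w} w~v₀ with N.rank w
    ... | 0 , r = # 0 , w~v₀ , r
    ... | 1 , r = # 1 , w~v₀ , r
    ... | 2 , r = ⊥-elim (N.¬Ranked₂ (neighbourhood-triangle-free k4) (w~v₀ , r))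

    cover-A : ∀ {w} → A w → ∃ λ c → lookup classes c w
    cover-A {w} aw with RA.rank w
    ... | 0 , r with hasNeighbourIn? P.RX.ranked₀? w
    ...   | yes h = # 3 , inj₁ (inj₂ ((aw , r) , h))
    ...   | no ¬h = # 2 , inj₂ (inj₂ ((aw , r) , ¬h))
    cover-A {w} aw | 1 , r with hasNeighbourIn? Q.RX.ranked₀? w
    ...   | yes h = # 5 , inj₂ ((aw , r) , h)
    ...   | no ¬h = # 4 , inj₂ ((aw , r) , ¬h)
    cover-A {w} aw | 2 , r = # 3 , inj₂ (aw , r)

    cover-far : ∀ {w} → Far w → ∃ λ c → lookup classes c w
    cover-far {w} far@(w≢v₀ , _) with ~-dichotomy w a₀ | ~-dichotomy w b₀
    ... | inj₁ w~a₀ | inj₁ w~b₀ = ⊥-elim (w≢v₀ (unique a₀~b₀ w~a₀ w~b₀ v₀~a₀ v₀~b₀))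
    ... | inj₁ w~a₀ | inj₂ w≁b₀ = [ (λ r → # 2 , inj₂ (inj₁ r)) , (λ r → # 3 , inj₁ (inj₁ r)) ]
                                    (P.X-ranks (far , w~a₀ , w≁b₀))
    ... | inj₂ w≁a₀ | inj₁ w~b₀ = [ (λ r → # 4 , inj₁ r) , (λ r → # 5 , inj₁ r) ] (Q.X-ranks (far , w~b₀ , w≁a₀))
    ... | inj₂ w≁a₀ | inj₂ w≁b₀ = cover-A (far , w≁a₀ , w≁b₀)

    cover : ∀ w → ∃ λ c → lookup classes c w
    cover w with w Fin.≟ v₀ | ~-dichotomy w v₀
    ... | yes refl | _         = # 2 , inj₁ refl
    ... | no _     | inj₁ w~v₀ = cover-N w~v₀
    ... | no w≢v₀  | inj₂ w≁v₀ = cover-far (w≢v₀ , w≁v₀)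

    colouring : χ≤ G 6
    colouring = colouring-by-classes classes cover
      (N.ranked-independent 0 ∷ N.ranked-independent 1 ∷
       ｛｝∪-independent (P.pair₀-independent 0) (proj₂ ∘ P.pair₀-far) ∷
       ∪-independent (P.pair₁-independent 0) (RA.ranked-independent 2) P.pair₁-third ∷
       Q.pair₀-independent 1 ∷ Q.pair₁-independent 1 ∷ [])

  diamond-free⇒χ≤6 : Free G P3∪P2 → K4Free → DiamondFree → χ≤ G 6
  diamond-free⇒χ≤6 P3∪P2-free k4 diamond-free
    with Fin.any? (λ a → Fin.any? λ b → Fin.any? λ c → a ~? b ×-dec b ~? c ×-dec a ~? c)
  ... | yes (_ , _ , _ , ab , bc , ac) =
    DiamondFreeCase.colouring P3∪P2-free k4 (unique-common-neighbours k4 diamond-free) ab ac bc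
  ... | no no-triangle =
    χ≤-mono (ℕ.m≤m+n 4 2) (triangle-free⇒χ≤4 P3∪P2-free λ ab bc ac → no-triangle (_ , _ , _ , ab , bc , ac))

  module DiamondCase (P3∪P2-free : Free G P3∪P2) (W4-free : Free G W4) (k4 : K4Free)
                     {t₀ t₁ t₂ x} (t₀~t₁ : t₀ ~ t₁) (t₁~t₂ : t₁ ~ t₂) (t₀~t₂ : t₀ ~ t₂)
                     (x~t₀ : x ~ t₀) (x~t₁ : x ~ t₁) (x≁t₂ : x ≁ t₂) (x≢t₂ : x ≢ t₂) where

    record Trace (w : V) (b₀ b₁ b₂ : Bool) : Set where
      constructor trace
      field
        at₀ : adj G w t₀ ≡ b₀
        at₁ : adj G w t₁ ≡ b₁
        at₂ : adj G w t₂ ≡ b₂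
    open Trace

    trace? : ∀ b₀ b₁ b₂ → Decidable (λ w → Trace w b₀ b₁ b₂)
    trace? b₀ b₁ b₂ w = map′ (λ (e₀ , e₁ , e₂) → trace e₀ e₁ e₂) (λ (trace e₀ e₁ e₂) → e₀ , e₁ , e₂)
      (adj G w t₀ Bool.≟ b₀ ×-dec adj G w t₁ Bool.≟ b₁ ×-dec adj G w t₂ Bool.≟ b₂)

    Y₀ Y₁ Y₂ A₀ : Pred V 0ℓ
    Y₀ w = Trace w true false false
    Y₁ w = Trace w false true false
    Y₂ w = Trace w false false true
    A₀ w = Trace w false false false

    data SeesTwo (w : V) : Set where
      sees₀₁ : w ~ t₀ → w ~ t₁ → SeesTwo w
      sees₀₂ : w ~ t₀ → w ~ t₂ → SeesTwo w
      sees₁₂ : w ~ t₁ → w ~ t₂ → SeesTwo w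

    X J K₂ K₃ R : Pred V 0ℓ
    X w = w ≢ t₀ × w ≢ t₁ × w ≢ t₂ × SeesTwo w
    J = Y₀ ∩ (_~ x) ∪ Y₁ ∩ (_~ x)
    K₂ = (Y₀ ∪ A₀) ∩ (_≁ x)
    K₃ = Y₁ ∩ (_≁ x)
    R = Y₂ ∪ A₀ ∩ (_~ x)

    Y₂? : Decidable Y₂
    Y₂? = trace? false false true

    J? : Decidable J
    J? w = (trace? true false false w ×-dec w ~? x) ⊎-dec (trace? false true false w ×-dec w ~? x)

    K₂? : Decidable K₂
    K₂? w = (trace? true false false w ⊎-dec trace? false false false w) ×-dec w ≁? x

    R? : Decidable R
    R? w = Y₂? w ⊎-dec (trace? false false false w ×-dec w ~? x)

    R-misses : ∀ {w} → R w → w ≁ t₀ × w ≁ t₁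
    R-misses (inj₁ (trace e₀ e₁ _))     = e₀ , e₁
    R-misses (inj₂ (trace e₀ e₁ _ , _)) = e₀ , e₁

    module RR = Ranking k4 R? (priority Y₂?) (priority-injective Y₂?)
                        (clustered-⊆ R-misses (edge-non-neighbourhood-clustered P3∪P2-free t₀~t₁))

    Top : Pred V 0ℓ
    Top = RR.Ranked 2

    -- The priority order puts Y₂ first, so a rank-2 vertex of Y₂ closes a triangle of Y₂-vertices,
    -- which together with t₂ would be a K4.
    top-in-A₀ : ∀ {v} → Top v → A₀ v × v ~ x
    top-in-A₀ (inj₂ a , _) = a
    top-in-A₀ {v} r₂@(inj₁ y₂ , _) = ⊥-elim (k4 (t₂~ y₀) (t₂~ y₁) (t₂~ y₂) w₀~w₁ w₀~v w₁~v)
      where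
      open RR.EarlierTriangle (RR.earlierTriangle r₂)
      y₀ = priority-first Y₂? y₂ w₀≺v
      y₁ = priority-first Y₂? y₂ w₁≺v
      t₂~ : ∀ {w} → Y₂ w → t₂ ~ w
      t₂~ y = ~-sym (at₂ y)

    crossing : ∀ {ti tj tk u w} → ti ~ tj → ti ~ tk → tj ~ tk → u ~ ti → u ~ tk → w ~ tj → w ~ tk →
               u ≢ tj → w ≢ ti → ¬ u ~ w
    crossing {ti} {tj} {u = u} {w} ij ik jk ui uk wj wk u≢tj w≢ti uw with ~-dichotomy u tj | ~-dichotomy w ti
    ... | inj₁ uj  | _        = k4 ij ik (~-sym ui) jk (~-sym uj) (~-sym uk)
    ... | inj₂ _   | inj₁ wi  = k4 ij ik (~-sym wi) jk (~-sym wj) (~-sym wk)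
    ... | inj₂ u≁j | inj₂ w≁i = no-W4 W4-free ui u≁j uw uk ij (≁-sym w≁i) ik (~-sym wj) jk wk u≢tj (w≢ti ∘ ≡.sym)

    X-independent : Independent X
    X-independent {u} {w} (u≢t₀ , u≢t₁ , u≢t₂ , su) (w≢t₀ , w≢t₁ , w≢t₂ , sw) = pairs su sw
      where
      common = common-neighbours-independent k4
      pairs : SeesTwo u → SeesTwo w → ¬ u ~ w
      pairs (sees₀₁ u₀ u₁) (sees₀₁ w₀ w₁) = common t₀~t₁ (u₀ , u₁) (w₀ , w₁)
      pairs (sees₀₂ u₀ u₂) (sees₀₂ w₀ w₂) = common t₀~t₂ (u₀ , u₂) (w₀ , w₂)
      pairs (sees₁₂ u₁ u₂) (sees₁₂ w₁ w₂) = common t₁~t₂ (u₁ , u₂) (w₁ , w₂)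
      pairs (sees₀₁ u₀ u₁) (sees₀₂ w₀ w₂) = crossing t₁~t₂ (~-sym t₀~t₁) (~-sym t₀~t₂) u₁ u₀ w₂ w₀ u≢t₂ w≢t₁
      pairs (sees₀₁ u₀ u₁) (sees₁₂ w₁ w₂) = crossing t₀~t₂ t₀~t₁ (~-sym t₁~t₂) u₀ u₁ w₂ w₁ u≢t₂ w≢t₀
      pairs (sees₀₂ u₀ u₂) (sees₀₁ w₀ w₁) = crossing (~-sym t₁~t₂) (~-sym t₀~t₂) (~-sym t₀~t₁) u₂ u₀ w₁ w₀ u≢t₁ w≢t₂
      pairs (sees₀₂ u₀ u₂) (sees₁₂ w₁ w₂) = crossing t₀~t₁ t₀~t₂ t₁~t₂ u₀ u₂ w₁ w₂ u≢t₁ w≢t₀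
      pairs (sees₁₂ u₁ u₂) (sees₀₁ w₀ w₁) = crossing (~-sym t₀~t₂) (~-sym t₁~t₂) t₀~t₁ u₂ u₁ w₀ w₁ u≢t₀ w≢t₂
      pairs (sees₁₂ u₁ u₂) (sees₀₂ w₀ w₂) = crossing (~-sym t₀~t₁) t₁~t₂ t₀~t₂ u₁ u₂ w₀ w₂ u≢t₀ w≢t₁

    J-independent : Independent J
    J-independent = ∪-independent
      (λ (yu , u~x) (yw , w~x) → common-neighbours-independent k4 (~-sym x~t₀) (at₀ yu , u~x) (at₀ yw , w~x))
      (λ (yu , u~x) (yw , w~x) → common-neighbours-independent k4 (~-sym x~t₁) (at₁ yu , u~x) (at₁ yw , w~x))
      λ (yu , u~x) (yw , w~x) u~w →
        no-W4 W4-free (at₀ yu) (at₁ yu) u~w u~x t₀~t₁ (≁-sym (at₀ yw)) (~-sym x~t₀) (~-sym (at₁ yw)) (~-sym x~t₁) w~x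
              (~-≁-apart t₁~t₂ (at₂ yu) ∘ ≡.sym) (~-≁-apart t₀~t₂ (at₂ yw))

    MissesPath : V → Pred V 0ℓ
    MissesPath t w = w ≁ x × w ≁ t × w ≁ t₂

    missesPath₀-independent : Independent (MissesPath t₀)
    missesPath₀-independent = P3-non-neighbourhood-independent P3∪P2-free x~t₀ t₀~t₂ x≁t₂ x≢t₂

    missesPath₁-independent : Independent (MissesPath t₁)
    missesPath₁-independent = P3-non-neighbourhood-independent P3∪P2-free x~t₁ t₁~t₂ x≁t₂ x≢t₂

    K₂⊆MissesPath₁ : K₂ ⊆ MissesPath t₁
    K₂⊆MissesPath₁ (inj₁ y , w≁x) = w≁x , at₁ y , at₂ y
    K₂⊆MissesPath₁ (inj₂ a , w≁x) = w≁x , at₁ a , at₂ a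

    K₃⊆MissesPath₀ : K₃ ⊆ MissesPath t₀
    K₃⊆MissesPath₀ (y , w≁x) = w≁x , at₀ y , at₂ y

    K₃-top-cross : ∀ {m v} → K₃ m → ((Top ∩ HasNeighbourIn J) ∩ HasNeighbourIn K₂) v → ¬ m ~ v
    K₃-top-cross {m} {v} km@(ym , m≁x) ((tv , _ , jj , v~j) , _ , kk , v~k) m~v = clash jj kk v~j v~k
      where
      av = proj₁ (top-in-A₀ tv)
      v~x = proj₂ (top-in-A₀ tv)
      v~m = ~-sym m~v
      clash : ∀ {j k} → J j → K₂ k → v ~ j → v ~ k → ⊥
      clash {j} (inj₂ (yj , j~x)) _ v~j _ with ~-dichotomy j m
      ... | inj₂ j≁m = no-P3∪P2 P3∪P2-free (~-sym v~j) v~m j≁m (~-≁-apart j~x m≁x) t₀~t₂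
                         (at₀ yj) (at₂ yj) (at₀ av) (at₂ av) (at₀ ym) (at₂ ym)
      ... | inj₁ j~m = no-W4 W4-free (~-sym x~t₁) (≁-sym (at₁ av)) (~-sym (at₁ ym)) (~-sym (at₁ yj)) (~-sym v~x)
                         (≁-sym m≁x) (~-sym j~x) v~m v~j (~-sym j~m)
                         (~-≁-apart (~-sym t₀~t₁) (at₀ av)) (~-≁-apart x~t₀ (at₀ ym))
      clash {j} {k} (inj₁ (yj , j~x)) (inj₁ yk , k≁x) v~j v~k with ~-dichotomy j k
      ... | inj₂ j≁k = no-P3∪P2 P3∪P2-free (~-sym v~j) v~k j≁k (~-≁-apart j~x k≁x) t₁~t₂
                         (at₁ yj) (at₂ yj) (at₁ av) (at₂ av) (at₁ yk) (at₂ yk)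
      ... | inj₁ j~k = no-W4 W4-free (~-sym x~t₀) (≁-sym (at₀ av)) (~-sym (at₀ yk)) (~-sym (at₀ yj)) (~-sym v~x)
                         (≁-sym k≁x) (~-sym j~x) v~k v~j (~-sym j~k)
                         (~-≁-apart t₀~t₁ (at₁ av)) (~-≁-apart x~t₁ (at₁ yk))
      clash {k = k} (inj₁ _) (inj₂ ak , k≁x) _ v~k with ~-dichotomy k m
      ... | inj₂ k≁m = no-P3∪P2 P3∪P2-free (~-sym v~k) v~m k≁m (~-≁-apart (at₁ ym) (at₁ ak) ∘ ≡.sym) t₀~t₂
                         (at₀ ak) (at₂ ak) (at₀ av) (at₂ av) (at₀ ym) (at₂ ym)
      ... | inj₁ k~m = missesPath₀-independent (k≁x , at₀ ak , at₂ ak) (K₃⊆MissesPath₀ km) k~m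

    classes : Vec (Pred V 0ℓ) 6
    classes = X
            ∷ ｛ t₂ ｝ ∪ J ∪ Top ∩ ∁ (HasNeighbourIn J)
            ∷ ｛ t₁ ｝ ∪ K₂ ∪ (Top ∩ HasNeighbourIn J) ∩ ∁ (HasNeighbourIn K₂)
            ∷ ｛ t₀ ｝ ∪ K₃ ∪ (Top ∩ HasNeighbourIn J) ∩ HasNeighbourIn K₂
            ∷ RR.Ranked 0 ∷ RR.Ranked 1 ∷ []

    cover-top : ∀ {w} → Top w → ∃ λ c → lookup classes c w
    cover-top {w} tw with hasNeighbourIn? J? w | hasNeighbourIn? K₂? w
    ... | no ¬j  | _     = # 1 , inj₂ (inj₂ (tw , ¬j))
    ... | yes j  | no ¬k = # 2 , inj₂ (inj₂ ((tw , j) , ¬k))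
    ... | yes j  | yes k = # 3 , inj₂ (inj₂ ((tw , j) , k))

    cover-R : ∀ {w} → R w → ∃ λ c → lookup classes c w
    cover-R {w} rw with RR.rank w
    ... | 0 , r = # 4 , rw , r
    ... | 1 , r = # 5 , rw , r
    ... | 2 , r = cover-top (rw , r)

    cover-outside : ∀ {w} → w ≢ t₀ → w ≢ t₁ → w ≢ t₂ → ∃ λ c → lookup classes c w
    cover-outside {w} w≢t₀ w≢t₁ w≢t₂ with adj G w t₀ in e₀ | adj G w t₁ in e₁ | adj G w t₂ in e₂ | ~-dichotomy w x
    ... | true  | true  | _     | _       = # 0 , w≢t₀ , w≢t₁ , w≢t₂ , sees₀₁ e₀ e₁
    ... | true  | false | true  | _       = # 0 , w≢t₀ , w≢t₁ , w≢t₂ , sees₀₂ e₀ e₂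
    ... | false | true  | true  | _       = # 0 , w≢t₀ , w≢t₁ , w≢t₂ , sees₁₂ e₁ e₂
    ... | true  | false | false | inj₁ w~x = # 1 , inj₂ (inj₁ (inj₁ (trace e₀ e₁ e₂ , w~x)))
    ... | true  | false | false | inj₂ w≁x = # 2 , inj₂ (inj₁ (inj₁ (trace e₀ e₁ e₂) , w≁x))
    ... | false | true  | false | inj₁ w~x = # 1 , inj₂ (inj₁ (inj₂ (trace e₀ e₁ e₂ , w~x)))
    ... | false | true  | false | inj₂ w≁x = # 3 , inj₂ (inj₁ (trace e₀ e₁ e₂ , w≁x))
    ... | false | false | true  | _       = cover-R (inj₁ (trace e₀ e₁ e₂))
    ... | false | false | false | inj₁ w~x = cover-R (inj₂ (trace e₀ e₁ e₂ , w~x))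
    ... | false | false | false | inj₂ w≁x = # 2 , inj₂ (inj₁ (inj₂ (trace e₀ e₁ e₂) , w≁x))

    cover : ∀ w → ∃ λ c → lookup classes c w
    cover w with w Fin.≟ t₀ | w Fin.≟ t₁ | w Fin.≟ t₂
    ... | yes refl | _        | _        = # 3 , inj₁ refl
    ... | no _     | yes refl | _        = # 2 , inj₁ refl
    ... | no _     | no _     | yes refl = # 1 , inj₁ refl
    ... | no w≢t₀  | no w≢t₁  | no w≢t₂  = cover-outside w≢t₀ w≢t₁ w≢t₂

    colouring : χ≤ G 6
    colouring = colouring-by-classes classes cover
      ( X-independent
      ∷ ｛｝∪-independent (∪-non-neighbours-independent J-independent top-independent)
                         [ [ at₂ ∘ proj₁ , at₂ ∘ proj₁ ] , top≁ at₂ ∘ proj₁ ]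
      ∷ ｛｝∪-independent (∪-non-neighbours-independent (independent-⊆ K₂⊆MissesPath₁ missesPath₁-independent)
                                                        (independent-⊆ proj₁ top-independent))
                         [ proj₁ ∘ proj₂ ∘ K₂⊆MissesPath₁ , top≁ at₁ ∘ proj₁ ∘ proj₁ ]
      ∷ ｛｝∪-independent (∪-independent (independent-⊆ K₃⊆MissesPath₀ missesPath₀-independent)
                                         (independent-⊆ (proj₁ ∘ proj₁) top-independent) K₃-top-cross)
                         [ at₀ ∘ proj₁ , top≁ at₀ ∘ proj₁ ∘ proj₁ ]
      ∷ RR.ranked-independent 0 ∷ RR.ranked-independent 1 ∷ [])
      where
      top-independent = RR.ranked-independent 2
      top≁ : ∀ {t : V} → (∀ {w} → A₀ w → adj G w t ≡ false) → ∀ {w} → Top w → w ≁ t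
      top≁ at tw = at (proj₁ (top-in-A₀ tw))

  diamond⇒χ≤6 : Free G P3∪P2 → Free G W4 → K4Free → ∀ {t₀ t₁ t₂ x} → Diamond t₀ t₁ t₂ x → χ≤ G 6
  diamond⇒χ≤6 P3∪P2-free W4-free k4 (t₀~t₁ , t₁~t₂ , t₀~t₂ , x~t₀ , x~t₁ , x≁t₂ , x≢t₂) =
    DiamondCase.colouring P3∪P2-free W4-free k4 t₀~t₁ t₁~t₂ t₀~t₂ x~t₀ x~t₁ x≁t₂ x≢t₂

lemma5p1 : (G : Graph) → Free G P3∪P2 → Free G W4 → Free G K4 → χ≤ G 6
lemma5p1 G P3∪P2-free W4-free K4-free with diamond? G | no-K4 G K4-free
... | yes (_ , _ , _ , _ , diamond) | k4 = diamond⇒χ≤6 G P3∪P2-free W4-free k4 diamond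
... | no no-diamond                 | k4 =
  diamond-free⇒χ≤6 G P3∪P2-free k4 λ diamond → no-diamond (_ , _ , _ , _ , diamond)
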